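{- Let $N$ be a matroid of rank at most $n$ on $[d]$ and let $\Delta=\Delta_N$. Then for every $2\le i\le n-1$ and every $X\subseteq[d]$ with $|X|\ge i+1$, the following are equivalent: (i) $\mathrm{rank}_N(X)\le i$; (ii) there exist $A\subseteq X$ with $|A|\le i$ and an edge $y$ of Type $i-|A|$ of $\Delta$ such that $X\setminus A\subseteq y$.
   Context: $\Delta_N$ is the labeled hypergraph whose edges of Type $j$ ($0\le j\le n-1$) are the nonempty cyclic flats of $N$ of rank $j$, where a cyclic flat is a flat of $N$ that is a union of circuits. -}

module Defs where

open import Data.Nat using (ℕ; suc; _+_; _≤_; _<_)
open import Data.Fin using (Fin)
open import Data.Fin.Subset using (Subset; _∈_; _∉_; _⊆_; _⊂_; _∪_; _∩_; ∣_∣; ⁅_⁆; ⊤; Nonempty)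
open import Data.Product using (Σ; ∃; _×_)
open import Relation.Binary.PropositionalEquality using (_≡_)

record Matroid (d : ℕ) : Set where
  field
    rank        : Subset d → ℕ
    rank-≤-card : ∀ X → rank X ≤ ∣ X ∣
    rank-mono   : ∀ X Y → X ⊆ Y → rank X ≤ rank Y
    rank-submod : ∀ X Y → rank (X ∪ Y) + rank (X ∩ Y) ≤ rank X + rank Y

module _ {d : ℕ} (N : Matroid d) where
  open Matroid N

  Independent : Subset d → Set
  Independent X = rank X ≡ ∣ X ∣

  Dependent : Subset d → Set
  Dependent X = rank X < ∣ X ∣

  Circuit : Subset d → Set
  Circuit C = Dependent C × (∀ Y → Y ⊂ C → Independent Y)

  Flat : Subset d → Set
  Flat F = ∀ e → e ∉ F → rank F < rank (F ∪ ⁅ e ⁆)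

  UnionOfCircuits : Subset d → Set
  UnionOfCircuits F = ∀ e → e ∈ F → Σ (Subset d) λ C → Circuit C × C ⊆ F × e ∈ C

  CyclicFlat : Subset d → Set
  CyclicFlat F = Flat F × UnionOfCircuits F

  EdgeOfType : (n j : ℕ) → Subset d → Set
  EdgeOfType n j y = suc j ≤ n × Nonempty y × CyclicFlat y × rank y ≡ j

{-# OPTIONS --safe #-}
-- Covering X by S and the points of X ─ S gives rank X ≤ rank S + ∣ X ─ S ∣ for every S, which
-- yields (ii) ⇒ (i) with S = y. Conversely, start from S = X and repeatedly add to S an element
-- that does not raise its rank, or delete a coloop of S; neither move increases
-- rank S + ∣ X ─ S ∣. When no move applies, S is a flat without coloops, hence a cyclic flat
-- (a non-coloop e lies in a circuit: shrink S while keeping e a non-coloop), and any A with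
-- X ─ S ⊆ A ⊆ X and ∣ A ∣ = i ∸ rank S does the job.
module Submission where

open import Defs
open import Data.Nat using (ℕ; zero; suc; _+_; _∸_; _≤_; _<_; z≤n; s≤s; _≤?_; _<?_)
open import Data.Nat.Properties hiding (_≟_)
open import Data.Nat.Induction using (<-wellFounded)
open import Data.Fin using (Fin; zero; suc; _≟_)
open import Data.Fin.Properties using (any?)
open import Data.Fin.Subset
open import Data.Fin.Subset.Properties
open import Data.Product using (Σ; _×_; _,_)
open import Data.Sum using (inj₁; inj₂)
open import Data.Vec using ([]; _∷_; here; there)
open import Function using (_∘_)
open import Function.Bundles using (_⇔_; mk⇔)
open import Induction.WellFounded using (Acc; acc)
open import Relation.Binary.PropositionalEquality
open import Relation.Nullary using (¬_; Dec; yes; no; contradiction)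
open import Relation.Nullary.Decidable using (_×-dec_; ¬?; decidable-stable)

x∈p─q⇒x∉q : ∀ {n} {x : Fin n} (p q : Subset n) → x ∈ p ─ q → x ∉ q
x∈p─q⇒x∉q (inside ∷ p) (outside ∷ q) here ()
x∈p─q⇒x∉q (_ ∷ p) (_ ∷ q) (there x∈) (there x∈q) = x∈p─q⇒x∉q p q x∈ x∈q

p⊆q∪p─q : ∀ {n} (p q : Subset n) → p ⊆ q ∪ (p ─ q)
p⊆q∪p─q p q {x} x∈p with x ∈? q
... | yes x∈q = x∈p∪q⁺ (inj₁ x∈q)
... | no  x∉q = x∈p∪q⁺ (inj₂ (x∈p∧x∉q⇒x∈p─q x∈p x∉q))

p─q⊆r⇒p─r⊆q : ∀ {n} {p q r : Subset n} → p ─ q ⊆ r → p ─ r ⊆ q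
p─q⊆r⇒p─r⊆q {p = p} {q} {r} p─q⊆r {x} x∈p─r with x ∈? q
... | yes x∈q = x∈q
... | no  x∉q = contradiction (p─q⊆r (x∈p∧x∉q⇒x∈p─q (p─q⊆p p r x∈p─r) x∉q))
                             (x∈p─q⇒x∉q p r x∈p─r)

p─p≡⊥ : ∀ {n} (p : Subset n) → p ─ p ≡ ⊥
p─p≡⊥ []            = refl
p─p≡⊥ (inside  ∷ p) = cong (outside ∷_) (p─p≡⊥ p)
p─p≡⊥ (outside ∷ p) = cong (outside ∷_) (p─p≡⊥ p)

∣p∩q∣+∣p─q∣≡∣p∣ : ∀ {n} (p q : Subset n) → ∣ p ∩ q ∣ + ∣ p ─ q ∣ ≡ ∣ p ∣
∣p∩q∣+∣p─q∣≡∣p∣ []            []            = refl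
∣p∩q∣+∣p─q∣≡∣p∣ (inside  ∷ p) (inside  ∷ q) = cong suc (∣p∩q∣+∣p─q∣≡∣p∣ p q)
∣p∩q∣+∣p─q∣≡∣p∣ (inside  ∷ p) (outside ∷ q) = trans (+-suc _ _) (cong suc (∣p∩q∣+∣p─q∣≡∣p∣ p q))
∣p∩q∣+∣p─q∣≡∣p∣ (outside ∷ p) (inside  ∷ q) = ∣p∩q∣+∣p─q∣≡∣p∣ p q
∣p∩q∣+∣p─q∣≡∣p∣ (outside ∷ p) (outside ∷ q) = ∣p∩q∣+∣p─q∣≡∣p∣ p q

∣p∣≤1+∣p-x∣ : ∀ {n} (p : Subset n) x → ∣ p ∣ ≤ suc ∣ p - x ∣
∣p∣≤1+∣p-x∣ (outside ∷ p) zero    = ≤-trans (n≤1+n ∣ p ∣) (≤-reflexive (cong (suc ∘ ∣_∣) (sym (p─⊥≡p p))))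
∣p∣≤1+∣p-x∣ (inside  ∷ p) zero    = ≤-reflexive (cong (suc ∘ ∣_∣) (sym (p─⊥≡p p)))
∣p∣≤1+∣p-x∣ (outside ∷ p) (suc x) = ∣p∣≤1+∣p-x∣ p x
∣p∣≤1+∣p-x∣ (inside  ∷ p) (suc x) = s≤s (∣p∣≤1+∣p-x∣ p x)

∣p─[q-x]∣≤1+∣p─q∣ : ∀ {n} (p q : Subset n) x → ∣ p ─ (q - x) ∣ ≤ suc ∣ p ─ q ∣
∣p─[q-x]∣≤1+∣p─q∣ p q x = ≤-trans (∣p∣≤1+∣p-x∣ (p ─ (q - x)) x) (s≤s (p⊆q⇒∣p∣≤∣q∣ shrunk))
  where
  shrunk : p ─ (q - x) - x ⊆ p ─ q
  shrunk {y} y∈ = x∈p∧x∉q⇒x∈p─q (p─q⊆p p (q - x) y∈p─[q-x]) y∉q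
    where
    y∈p─[q-x] = p─q⊆p _ ⁅ x ⁆ y∈
    y∉q : y ∉ q
    y∉q y∈q = x∈p─q⇒x∉q p (q - x) y∈p─[q-x]
                (x∈p∧x≢y⇒x∈p-y y∈q (x∉⁅y⁆⇒x≢y (x∈p─q⇒x∉q _ ⁅ x ⁆ y∈)))

∣p─q∪r∣≤∣p─q∣ : ∀ {n} (p q r : Subset n) → ∣ p ─ (q ∪ r) ∣ ≤ ∣ p ─ q ∣
∣p─q∪r∣≤∣p─q∣ p q r rewrite sym (p─q─r≡p─q∪r p q r) = ∣p─q∣≤∣p∣ (p ─ q) r

∣p─q∪⁅x⁆∣<∣p─q∣ : ∀ {n} (p q : Subset n) {x} → x ∈ p ─ q → ∣ p ─ (q ∪ ⁅ x ⁆) ∣ < ∣ p ─ q ∣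
∣p─q∪⁅x⁆∣<∣p─q∣ p q {x} x∈p─q rewrite sym (p─q─r≡p─q∪r p q ⁅ x ⁆) = x∈p⇒∣p-x∣<∣p∣ x∈p─q

∣p─q∣<∣p∣⇒q≢∅ : ∀ {n} (p q : Subset n) → ∣ p ─ q ∣ < ∣ p ∣ → Nonempty q
∣p─q∣<∣p∣⇒q≢∅ p q ∣p─q∣<∣p∣ with nonempty? q
... | yes q≢∅ = q≢∅
... | no  q≡∅ rewrite Empty-unique q≡∅ | p─⊥≡p p = contradiction ∣p─q∣<∣p∣ (<-irrefl refl)

⊆-between : ∀ {n} (P X : Subset n) {k} → P ⊆ X → ∣ P ∣ ≤ k → k ≤ ∣ X ∣ →
            Σ (Subset n) λ A → P ⊆ A × A ⊆ X × ∣ A ∣ ≡ k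
⊆-between []            []            {zero}  _    _ _ = [] , ⊆-refl , ⊆-refl , refl
⊆-between (inside  ∷ P) (outside ∷ X)         P⊆X  _ _ = contradiction (P⊆X here) λ ()
⊆-between (inside  ∷ P) (inside  ∷ X) {suc k} P⊆X (s≤s P≤k) (s≤s k≤X) =
  let A , P⊆A , A⊆X , ∣A∣≡k = ⊆-between P X (drop-∷-⊆ P⊆X) P≤k k≤X
  in inside ∷ A , s⊆s P⊆A , s⊆s A⊆X , cong suc ∣A∣≡k
⊆-between (outside ∷ P) (outside ∷ X)         P⊆X P≤k k≤X =
  let A , P⊆A , A⊆X , ∣A∣≡k = ⊆-between P X (drop-∷-⊆ P⊆X) P≤k k≤X
  in outside ∷ A , s⊆s P⊆A , s⊆s A⊆X , ∣A∣≡k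
⊆-between (outside ∷ P) (inside  ∷ X) {k}     P⊆X P≤k k≤1+X with k ≤? ∣ X ∣
... | yes k≤X = let A , P⊆A , A⊆X , ∣A∣≡k = ⊆-between P X (drop-∷-⊆ P⊆X) P≤k k≤X
                in outside ∷ A , s⊆s P⊆A , out⊆ A⊆X , ∣A∣≡k
... | no  k≰X = inside ∷ X , out⊆ (drop-∷-⊆ P⊆X) , ⊆-refl , ≤-antisym (≰⇒> k≰X) k≤1+X

module _ {d : ℕ} (N : Matroid d) where
  open Matroid N renaming (rank to r)

  rank-∪ : ∀ X Y → r (X ∪ Y) ≤ r X + r Y
  rank-∪ X Y = m+n≤o⇒m≤o (r (X ∪ Y)) (rank-submod X Y)

  coverBound : Subset d → Subset d → ℕ
  coverBound X S = r S + ∣ X ─ S ∣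

  rank≤coverBound : ∀ X S → r X ≤ coverBound X S
  rank≤coverBound X S = begin
    r X                 ≤⟨ rank-mono X (S ∪ (X ─ S)) (p⊆q∪p─q X S) ⟩
    r (S ∪ (X ─ S))     ≤⟨ rank-∪ S (X ─ S) ⟩
    r S + r (X ─ S)     ≤⟨ +-monoʳ-≤ (r S) (rank-≤-card (X ─ S)) ⟩
    r S + ∣ X ─ S ∣     ∎
    where open ≤-Reasoning

  coverBound-self : ∀ X → coverBound X X ≡ r X
  coverBound-self X rewrite p─p≡⊥ X | ∣⊥∣≡0 d = +-identityʳ (r X)

  card≤rank⇒independent : ∀ {X} → ∣ X ∣ ≤ r X → Independent N X
  card≤rank⇒independent {X} = ≤-antisym (rank-≤-card X)

  independent-⊆ : ∀ {X Y} → Y ⊆ X → Independent N X → Independent N Y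
  independent-⊆ {X} {Y} Y⊆X X-indep =
    card≤rank⇒independent (+-cancelʳ-≤ ∣ X ─ Y ∣ ∣ Y ∣ (r Y) (begin
    ∣ Y ∣ + ∣ X ─ Y ∣       ≤⟨ +-monoˡ-≤ ∣ X ─ Y ∣ (p⊆q⇒∣p∣≤∣q∣ (λ y∈Y → x∈p∩q⁺ (Y⊆X y∈Y , y∈Y))) ⟩
    ∣ X ∩ Y ∣ + ∣ X ─ Y ∣   ≡⟨ ∣p∩q∣+∣p─q∣≡∣p∣ X Y ⟩
    ∣ X ∣                   ≡⟨ X-indep ⟨
    r X                     ≤⟨ rank≤coverBound X Y ⟩
    r Y + ∣ X ─ Y ∣         ∎))
    where open ≤-Reasoning

  Coloop : Subset d → Fin d → Set
  Coloop S e = r (S - e) < r S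

  coloop? : ∀ S e → Dec (Coloop S e)
  coloop? S e = r (S - e) <? r S

  Coloopless : Subset d → Set
  Coloopless S = ∀ e → e ∈ S → ¬ Coloop S e

  coloop-⊆ : ∀ {T D f} → f ∈ T → T ⊆ D → Coloop D f → Coloop T f
  coloop-⊆ {T} {D} {f} f∈T T⊆D f-coloop = +-cancelˡ-< (r (D - f)) (r (T - f)) (r T) (begin-strict
    r (D - f) + r (T - f)                 <⟨ +-monoˡ-< (r (T - f)) f-coloop ⟩
    r D + r (T - f)                       ≤⟨ +-mono-≤ (rank-mono _ _ D⊆) (rank-mono _ _ T-f⊆) ⟩
    r ((D - f) ∪ T) + r ((D - f) ∩ T)     ≤⟨ rank-submod (D - f) T ⟩
    r (D - f) + r T                       ∎)
    where
    open ≤-Reasoning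
    D⊆ : D ⊆ (D - f) ∪ T
    D⊆ {x} x∈D with x ≟ f
    ... | yes refl = x∈p∪q⁺ (inj₂ f∈T)
    ... | no  x≢f  = x∈p∪q⁺ (inj₁ (x∈p∧x≢y⇒x∈p-y x∈D x≢f))
    T-f⊆ : T - f ⊆ (D - f) ∩ T
    T-f⊆ x∈T-f = x∈p∩q⁺ (x∈p∧x∉q⇒x∈p─q (T⊆D x∈T) (x∈p─q⇒x∉q T ⁅ f ⁆ x∈T-f) , x∈T)
      where x∈T = p─q⊆p T ⁅ f ⁆ x∈T-f

  coloops⇒independent : ∀ D → (∀ f → f ∈ D → Coloop D f) → Independent N D
  coloops⇒independent D = go D (<-wellFounded ∣ D ∣)
    where
    go : ∀ D → Acc _<_ ∣ D ∣ → (∀ f → f ∈ D → Coloop D f) → Independent N D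
    go D (acc rec) coloops with nonempty? D
    ... | no  D≡∅ =
      card≤rank⇒independent (≤-trans (≤-reflexive (trans (cong ∣_∣ (Empty-unique D≡∅)) (∣⊥∣≡0 d))) z≤n)
    ... | yes (g , g∈D) = card≤rank⇒independent (begin
      ∣ D ∣               ≤⟨ ∣p∣≤1+∣p-x∣ D g ⟩
      suc ∣ D - g ∣       ≡⟨ cong suc (go (D - g) (rec (x∈p⇒∣p-x∣<∣p∣ g∈D)) coloops-D-g) ⟨
      suc (r (D - g))     ≤⟨ coloops g g∈D ⟩
      r D                 ∎)
      where
      open ≤-Reasoning
      coloops-D-g : ∀ f → f ∈ D - g → Coloop (D - g) f
      coloops-D-g f f∈D-g = coloop-⊆ f∈D-g (p─q⊆p D ⁅ g ⁆) (coloops f (p─q⊆p D ⁅ g ⁆ f∈D-g))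

  circuit-criterion : ∀ {C e} → e ∈ C → ¬ Coloop C e →
                      (∀ f → f ∈ C → f ≢ e → Coloop (C - f) e) → Circuit N C
  circuit-criterion {C} {e} e∈C e-not-coloop e-coloop-below = dependent , proper-independent
    where
    open ≤-Reasoning
    rC≤rC-e : r C ≤ r (C - e)
    rC≤rC-e = ≮⇒≥ e-not-coloop

    C-e-independent : Independent N (C - e)
    C-e-independent = coloops⇒independent (C - e) λ f f∈C-e →
      let f∈C = p─q⊆p C ⁅ e ⁆ f∈C-e
          f≢e = x∉⁅y⁆⇒x≢y (x∈p─q⇒x∉q C ⁅ e ⁆ f∈C-e)
      in begin-strict
        r (C - e - f)   ≡⟨ cong r (p─x─y≡p─y─x C e f) ⟩
        r (C - f - e)   <⟨ e-coloop-below f f∈C f≢e ⟩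
        r (C - f)       ≤⟨ rank-mono (C - f) C (p─q⊆p C ⁅ f ⁆) ⟩
        r C             ≤⟨ rC≤rC-e ⟩
        r (C - e)       ∎

    C-f-independent : ∀ f → f ∈ C → Independent N (C - f)
    C-f-independent f f∈C with f ≟ e
    ... | yes refl = C-e-independent
    ... | no  f≢e  = card≤rank⇒independent (begin
      ∣ C - f ∣              ≤⟨ ∣p∣≤1+∣p-x∣ (C - f) e ⟩
      suc ∣ C - f - e ∣      ≡⟨ cong suc (independent-⊆ C-f-e⊆C-e C-e-independent) ⟨
      suc (r (C - f - e))    ≤⟨ e-coloop-below f f∈C f≢e ⟩
      r (C - f)              ∎)
      where
      C-f-e⊆C-e : C - f - e ⊆ C - e
      C-f-e⊆C-e = ⊆-trans (⊆-reflexive (p─x─y≡p─y─x C f e)) (p─q⊆p (C - e) ⁅ f ⁆)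

    dependent : Dependent N C
    dependent = begin-strict
      r C          ≤⟨ rC≤rC-e ⟩
      r (C - e)    ≤⟨ rank-≤-card (C - e) ⟩
      ∣ C - e ∣    <⟨ x∈p⇒∣p-x∣<∣p∣ e∈C ⟩
      ∣ C ∣        ∎

    proper-independent : ∀ Y → Y ⊂ C → Independent N Y
    proper-independent Y (Y⊆C , f , f∈C , f∉Y) =
      independent-⊆ (λ y∈Y → x∈p∧x≢y⇒x∈p-y (Y⊆C y∈Y) λ { refl → f∉Y y∈Y }) (C-f-independent f f∈C)

  circuit-through : ∀ {C e} → e ∈ C → ¬ Coloop C e →
                    Σ (Subset d) λ C′ → Circuit N C′ × C′ ⊆ C × e ∈ C′
  circuit-through {C} {e} = go C (<-wellFounded ∣ C ∣)
    where
    go : ∀ C → Acc _<_ ∣ C ∣ → e ∈ C → ¬ Coloop C e →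
         Σ (Subset d) λ C′ → Circuit N C′ × C′ ⊆ C × e ∈ C′
    go C (acc rec) e∈C e-not-coloop
      with any? (λ f → (f ∈? C) ×-dec ¬? (f ≟ e) ×-dec ¬? (coloop? (C - f) e))
    ... | yes (f , f∈C , f≢e , e-not-coloop′) =
      let C′ , C′-circuit , C′⊆C-f , e∈C′ =
            go (C - f) (rec (x∈p⇒∣p-x∣<∣p∣ f∈C)) (x∈p∧x≢y⇒x∈p-y e∈C (f≢e ∘ sym)) e-not-coloop′
      in C′ , C′-circuit , ⊆-trans C′⊆C-f (p─q⊆p C ⁅ f ⁆) , e∈C′
    ... | no  C-minimal =
      C , circuit-criterion e∈C e-not-coloop e-coloop-below , ⊆-refl , e∈C
      where
      e-coloop-below : ∀ f → f ∈ C → f ≢ e → Coloop (C - f) e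
      e-coloop-below f f∈C f≢e =
        decidable-stable (coloop? (C - f) e) λ e-not-coloop′ → C-minimal (f , f∈C , f≢e , e-not-coloop′)

  coloopless⇒unionOfCircuits : ∀ {S} → Coloopless S → UnionOfCircuits N S
  coloopless⇒unionOfCircuits S-coloopless e e∈S = circuit-through e∈S (S-coloopless e e∈S)

  coverBound-∪ : ∀ X S e → r (S ∪ ⁅ e ⁆) ≤ r S → coverBound X (S ∪ ⁅ e ⁆) ≤ coverBound X S
  coverBound-∪ X S e rS∪e≤rS = +-mono-≤ rS∪e≤rS (∣p─q∪r∣≤∣p─q∣ X S ⁅ e ⁆)

  coverBound-─ : ∀ X S e → Coloop S e → coverBound X (S - e) ≤ coverBound X S
  coverBound-─ X S e e-coloop = begin
    r (S - e) + ∣ X ─ (S - e) ∣    ≤⟨ +-monoʳ-≤ (r (S - e)) (∣p─[q-x]∣≤1+∣p─q∣ X S e) ⟩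
    r (S - e) + suc ∣ X ─ S ∣      ≡⟨ +-suc (r (S - e)) ∣ X ─ S ∣ ⟩
    suc (r (S - e)) + ∣ X ─ S ∣    ≤⟨ +-monoˡ-≤ ∣ X ─ S ∣ e-coloop ⟩
    r S + ∣ X ─ S ∣                ∎
    where open ≤-Reasoning

  coloopless-flat-coverBound≤ : ∀ X {b} S → coverBound X S ≤ b →
                                Σ (Subset d) λ F → Flat N F × Coloopless F × coverBound X F ≤ b
  coloopless-flat-coverBound≤ X S = go S (<-wellFounded (measure S))
    where
    -- Adding keeps the rank and shrinks ⊤ ─ S; deleting a coloop lowers the rank by one and
    -- grows ⊤ ─ S by one, so the rank has to be counted twice.
    measure : Subset d → ℕ
    measure S = r S + coverBound ⊤ S

    go : ∀ {b} S → Acc _<_ (measure S) → coverBound X S ≤ b →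
         Σ (Subset d) λ F → Flat N F × Coloopless F × coverBound X F ≤ b
    go S (acc rec) S≤b with any? (λ e → ¬? (e ∈? S) ×-dec (r (S ∪ ⁅ e ⁆) ≤? r S))
    ... | yes (e , e∉S , rS∪e≤rS) =
      go (S ∪ ⁅ e ⁆) (rec (+-mono-≤-< rS∪e≤rS (+-mono-≤-< rS∪e≤rS ∣⊤─S∪e∣<∣⊤─S∣)))
         (≤-trans (coverBound-∪ X S e rS∪e≤rS) S≤b)
      where
      ∣⊤─S∪e∣<∣⊤─S∣ : ∣ ⊤ ─ (S ∪ ⁅ e ⁆) ∣ < ∣ ⊤ ─ S ∣
      ∣⊤─S∪e∣<∣⊤─S∣ = ∣p─q∪⁅x⁆∣<∣p─q∣ ⊤ S (x∈p∧x∉q⇒x∈p─q ∈⊤ e∉S)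
    ... | no  S-closed with any? (λ e → (e ∈? S) ×-dec coloop? S e)
    ...   | yes (e , e∈S , e-coloop) =
      go (S - e) (rec (+-mono-<-≤ e-coloop (coverBound-─ ⊤ S e e-coloop)))
         (≤-trans (coverBound-─ X S e e-coloop) S≤b)
    ...   | no  S-coloopless =
      S , (λ e e∉S → ≰⇒> λ rS∪e≤rS → S-closed (e , e∉S , rS∪e≤rS))
        , (λ e e∈S e-coloop → S-coloopless (e , e∈S , e-coloop))
        , S≤b

  cyclicFlat-coverBound≤rank : ∀ X → Σ (Subset d) λ F → CyclicFlat N F × coverBound X F ≤ r X
  cyclicFlat-coverBound≤rank X =
    let F , F-flat , F-coloopless , F≤rX = coloopless-flat-coverBound≤ X X (≤-reflexive (coverBound-self X))
    in F , (F-flat , coloopless⇒unionOfCircuits F-coloopless) , F≤rX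

  CoveredByEdge : ℕ → ℕ → Subset d → Set
  CoveredByEdge n i X = Σ (Subset d) λ A → A ⊆ X × ∣ A ∣ ≤ i ×
                          Σ (Subset d) λ y → EdgeOfType N n (i ∸ ∣ A ∣) y × (X ─ A) ⊆ y

  coveredByEdge⇒rank≤ : ∀ {n i X} → CoveredByEdge n i X → r X ≤ i
  coveredByEdge⇒rank≤ {i = i} {X} (A , _ , ∣A∣≤i , y , (_ , _ , _ , ry≡i∸∣A∣) , X─A⊆y) = begin
    r X                ≤⟨ rank≤coverBound X y ⟩
    r y + ∣ X ─ y ∣    ≤⟨ +-mono-≤ (≤-reflexive ry≡i∸∣A∣) (p⊆q⇒∣p∣≤∣q∣ (p─q⊆r⇒p─r⊆q X─A⊆y)) ⟩
    i ∸ ∣ A ∣ + ∣ A ∣  ≡⟨ m∸n+n≡m ∣A∣≤i ⟩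
    i                  ∎
    where open ≤-Reasoning

  cyclicFlat⇒coveredByEdge : ∀ {n i X F} → suc i ≤ n → i < ∣ X ∣ → CyclicFlat N F →
                             coverBound X F ≤ i → CoveredByEdge n i X
  cyclicFlat⇒coveredByEdge {n} {i} {X} {F} i<n i<∣X∣ F-cyclic F≤i =
    let A , X─F⊆A , A⊆X , ∣A∣≡i∸rF = ⊆-between (X ─ F) X (p─q⊆p X F) ∣X─F∣≤i∸rF i∸rF≤∣X∣
    in A , A⊆X , ≤-trans (≤-reflexive ∣A∣≡i∸rF) (m∸n≤m i (r F)) ,
       F , edge A ∣A∣≡i∸rF , p─q⊆r⇒p─r⊆q X─F⊆A
    where
    rF≤i : r F ≤ i
    rF≤i = m+n≤o⇒m≤o (r F) F≤i

    ∣X─F∣≤i : ∣ X ─ F ∣ ≤ i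
    ∣X─F∣≤i = m+n≤o⇒n≤o (r F) F≤i

    ∣X─F∣≤i∸rF : ∣ X ─ F ∣ ≤ i ∸ r F
    ∣X─F∣≤i∸rF = m+n≤o⇒m≤o∸n ∣ X ─ F ∣ (≤-trans (≤-reflexive (+-comm ∣ X ─ F ∣ (r F))) F≤i)

    i∸rF≤∣X∣ : i ∸ r F ≤ ∣ X ∣
    i∸rF≤∣X∣ = ≤-trans (m∸n≤m i (r F)) (<⇒≤ i<∣X∣)

    edge : ∀ A → ∣ A ∣ ≡ i ∸ r F → EdgeOfType N n (i ∸ ∣ A ∣) F
    edge A ∣A∣≡i∸rF =
      ≤-trans (s≤s (m∸n≤m i ∣ A ∣)) i<n ,
      ∣p─q∣<∣p∣⇒q≢∅ X F (≤-<-trans ∣X─F∣≤i i<∣X∣) ,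
      F-cyclic ,
      sym (trans (cong (i ∸_) ∣A∣≡i∸rF) (m∸[m∸n]≡n rF≤i))

lemma4p2 : {d n : ℕ} (N : Matroid d) → Matroid.rank N ⊤ ≤ n →
    (i : ℕ) → 2 ≤ i → suc i ≤ n →
    (X : Subset d) → suc i ≤ ∣ X ∣ →
    (Matroid.rank N X ≤ i
      ⇔ Σ (Subset d) λ A → A ⊆ X × ∣ A ∣ ≤ i ×
          Σ (Subset d) λ y → EdgeOfType N n (i ∸ ∣ A ∣) y × (X ─ A) ⊆ y)
lemma4p2 {n = n} N _ i _ i<n X i<∣X∣ = mk⇔ rank≤i⇒covered (coveredByEdge⇒rank≤ N)
  where
  rank≤i⇒covered : Matroid.rank N X ≤ i → CoveredByEdge N n i X
  rank≤i⇒covered rX≤i =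
    let F , F-cyclic , F≤rX = cyclicFlat-coverBound≤rank N X
    in cyclicFlat⇒coveredByEdge N i<n i<∣X∣ F-cyclic (≤-trans F≤rX rX≤i)
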